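{- Let $g(x,y)=\sum_{i,j=-\infty}^{\infty}c(i,j)x^iy^j\neq 0$ be a formal bilateral series with $g\perp g$, and let $f(x,y)$ be a formal bilateral series. Then $f\perp g$ if and only if there exist integers $m_0,k_0$ with $c(m_0,k_0)\neq 0$ and formal Laurent series $P(x)=\sum_{i=-\infty}^{\infty}p_ix^i$, $Q(x)=\sum_{i=-\infty}^{\infty}q_ix^i$ (with arbitrary complex coefficient sequences $p_i,q_i$) such that $$f(x,y)=\frac{1}{c(m_0,k_0)}\Big(P(x)\,[x^{m_0}]g(x,y)-Q(x)\,[x^{k_0}]g(x,y)\Big),$$ where $[x^{m}]g(x,y)=\sum_{j=-\infty}^{\infty}c(m,j)y^j$ denotes the coefficient of $x^{m}$ in $g(x,y)$.
   Context: A formal bilateral series in $x,y$ is an expression $\sum_{i,j\in\mathbb{Z}}\lambda(i,j)x^iy^j$ with arbitrary complex coefficients. For two such series $f,g$, we say $f$ is orthogonal to $g$, written $f\perp g$, if $$g(a,b)f(x,c)-g(a,c)f(x,b)+g(b,c)f(x,a)=0$$ identically in the four independent variables $a,b,c,x$ (each product involves series in disjoint variables, hence is well defined). -}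

module Defs where

open import Level using (Level; _⊔_) renaming (suc to lsuc)
open import Algebra.Bundles using (CommutativeRing)
open import Data.Integer using (ℤ)
open import Relation.Nullary using (¬_)
open import Data.Product using (∃₂)

record Field (c ℓ : Level) : Set (lsuc (c ⊔ ℓ)) where
  field
    commutativeRing : CommutativeRing c ℓ
  open CommutativeRing commutativeRing public
  field
    inv     : (x : Carrier) → ¬ (x ≈ 0#) → Carrier
    inverse : (x : Carrier) (x≉0 : ¬ (x ≈ 0#)) → x * inv x x≉0 ≈ 1#
    1≉0     : ¬ (1# ≈ 0#)

module _ {c ℓ : Level} (K : Field c ℓ) where
  open Field K

  -- A formal bilateral series Σ_{i,j∈ℤ} λ(i,j) x^i y^j, represented by
  -- its (arbitrary) coefficient function.
  BSeries : Set c
  BSeries = ℤ → ℤ → Carrier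

  LSeries : Set c
  LSeries = ℤ → Carrier

  coeffX : BSeries → ℤ → LSeries
  coeffX g m = g m

  -- f ⊥ g : g(a,b) f(x,c) - g(a,c) f(x,b) + g(b,c) f(x,a) = 0 identically.
  -- The coefficient of a^i b^j c^l x^k on the left-hand side is
  --   g(i,j) f(k,l) - g(i,l) f(k,j) + g(j,l) f(k,i).
  _⊥_ : BSeries → BSeries → Set ℓ
  f ⊥ g = ∀ (i j l k : ℤ) →
    (g i j * f k l - g i l * f k j) + g j l * f k i ≈ 0#

  NonZeroSeries : BSeries → Set ℓ
  NonZeroSeries g = ∃₂ λ (i j : ℤ) → ¬ (g i j ≈ 0#)

{-# OPTIONS --safe #-}
module Submission where

open import Defs
open import Level using (Level; _⊔_)
open import Data.Integer using (ℤ)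
open import Data.Product using (Σ; ∃₂; _,_)
open import Relation.Nullary using (¬_)
open import Function.Bundles using (_⇔_; mk⇔; Equivalence)
open import Algebra.Bundles using (CommutativeRing)
import Algebra.Properties.AbelianGroup as AbelianGroupProperties
import Algebra.Properties.CommutativeSemigroup as CommutativeSemigroupProperties
import Algebra.Properties.Ring as RingProperties
import Relation.Binary.Reasoning.Setoid as SetoidReasoning

-- The x^k-coefficient of the relation f ⊥ g involves only the row h = [x^k] f, and
-- it says g(a,b) h(c) - g(a,c) h(b) + g(b,c) h(a) = 0, a condition linear in h.
-- So f ⊥ g means that all rows of f lie in a submodule, which by g ⊥ g contains
-- the rows of g; this gives "if".  Conversely, comparing coefficients of a^m₀ b^k₀
-- in that condition gives c(m₀,k₀) h(y) = h(k₀) [x^m₀]g - h(m₀) [x^k₀]g, so "only if"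
-- holds with P(x) = [y^k₀] f and Q(x) = [y^m₀] f.

module Rows {c ℓ : Level} (R : CommutativeRing c ℓ) {a : Level} {I : Set a} where
  open CommutativeRing R
  open SetoidReasoning setoid
  open AbelianGroupProperties +-abelianGroup using (⁻¹-∙-comm; ⁻¹-anti-homo‿-; x∙y⁻¹≈ε⇒x≈y)
  open CommutativeSemigroupProperties +-commutativeSemigroup using (interchange)
  open CommutativeSemigroupProperties *-commutativeSemigroup using (x∙yz≈y∙xz)
  open RingProperties ring using (-1*x≈-x; x[y-z]≈xy-xz)

  orthogonalityForm : (I → I → Carrier) → (I → Carrier) → I → I → I → Carrier
  orthogonalityForm g h i j l = (g i j * h l - g i l * h j) + g j l * h i

  infix 4 _⊥₁_
  _⊥₁_ : (I → Carrier) → (I → I → Carrier) → Set (a ⊔ ℓ)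
  h ⊥₁ g = ∀ i j l → orthogonalityForm g h i j l ≈ 0#

  module _ (g : I → I → Carrier) where

    orthogonalityForm-cong : ∀ {h h′ : I → Carrier} → (∀ j → h j ≈ h′ j) →
      ∀ i j l → orthogonalityForm g h i j l ≈ orthogonalityForm g h′ i j l
    orthogonalityForm-cong h≈h′ i j l =
      +-cong (+-cong (*-congˡ (h≈h′ l)) (-‿cong (*-congˡ (h≈h′ j)))) (*-congˡ (h≈h′ i))

    orthogonalityForm-scale : ∀ (x : Carrier) (h : I → Carrier) i j l →
      orthogonalityForm g (λ j → x * h j) i j l ≈ x * orthogonalityForm g h i j l
    orthogonalityForm-scale x h i j l = begin
      (g i j * (x * h l) - g i l * (x * h j)) + g j l * (x * h i)
        ≈⟨ +-cong (+-cong (x∙yz≈y∙xz _ x _) (-‿cong (x∙yz≈y∙xz _ x _))) (x∙yz≈y∙xz _ x _) ⟩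
      (x * (g i j * h l) - x * (g i l * h j)) + x * (g j l * h i)
        ≈⟨ +-congʳ (x[y-z]≈xy-xz x _ _) ⟨
      x * (g i j * h l - g i l * h j) + x * (g j l * h i)
        ≈⟨ distribˡ x _ _ ⟨
      x * orthogonalityForm g h i j l ∎

    orthogonalityForm-add : ∀ (h₁ h₂ : I → Carrier) i j l →
      orthogonalityForm g (λ j → h₁ j + h₂ j) i j l
        ≈ orthogonalityForm g h₁ i j l + orthogonalityForm g h₂ i j l
    orthogonalityForm-add h₁ h₂ i j l = begin
      (g i j * (h₁ l + h₂ l) - g i l * (h₁ j + h₂ j)) + g j l * (h₁ i + h₂ i)
        ≈⟨ +-cong (+-cong (distribˡ _ _ _) (-‿cong (distribˡ _ _ _))) (distribˡ _ _ _) ⟩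
      ((A₁ + A₂) - (B₁ + B₂)) + (C₁ + C₂)
        ≈⟨ +-congʳ (+-congˡ (⁻¹-∙-comm B₁ B₂)) ⟨
      ((A₁ + A₂) + (- B₁ + - B₂)) + (C₁ + C₂)
        ≈⟨ +-congʳ (interchange A₁ A₂ (- B₁) (- B₂)) ⟩
      ((A₁ - B₁) + (A₂ - B₂)) + (C₁ + C₂)
        ≈⟨ interchange (A₁ - B₁) (A₂ - B₂) C₁ C₂ ⟩
      ((A₁ - B₁) + C₁) + ((A₂ - B₂) + C₂) ∎
      where
        A₁ = g i j * h₁ l; A₂ = g i j * h₂ l
        B₁ = g i l * h₁ j; B₂ = g i l * h₂ j
        C₁ = g j l * h₁ i; C₂ = g j l * h₂ i

    ⊥₁-resp : ∀ {h h′ : I → Carrier} → (∀ j → h j ≈ h′ j) → h ⊥₁ g → h′ ⊥₁ g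
    ⊥₁-resp h≈h′ h⊥g i j l = trans (sym (orthogonalityForm-cong h≈h′ i j l)) (h⊥g i j l)

    ⊥₁-scale : ∀ x {h : I → Carrier} → h ⊥₁ g → (λ j → x * h j) ⊥₁ g
    ⊥₁-scale x {h} h⊥g i j l = begin
      orthogonalityForm g (λ j → x * h j) i j l ≈⟨ orthogonalityForm-scale x h i j l ⟩
      x * orthogonalityForm g h i j l            ≈⟨ *-congˡ (h⊥g i j l) ⟩
      x * 0#                                     ≈⟨ zeroʳ x ⟩
      0#                                         ∎

    ⊥₁-add : ∀ {h₁ h₂ : I → Carrier} → h₁ ⊥₁ g → h₂ ⊥₁ g → (λ j → h₁ j + h₂ j) ⊥₁ g
    ⊥₁-add {h₁} {h₂} h₁⊥g h₂⊥g i j l = begin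
      orthogonalityForm g (λ j → h₁ j + h₂ j) i j l ≈⟨ orthogonalityForm-add h₁ h₂ i j l ⟩
      orthogonalityForm g h₁ i j l + orthogonalityForm g h₂ i j l
                                                    ≈⟨ +-cong (h₁⊥g i j l) (h₂⊥g i j l) ⟩
      0# + 0#                                       ≈⟨ +-identityˡ 0# ⟩
      0#                                            ∎

    ⊥₁-sub : ∀ {h₁ h₂ : I → Carrier} → h₁ ⊥₁ g → h₂ ⊥₁ g → (λ j → h₁ j - h₂ j) ⊥₁ g
    ⊥₁-sub h₁⊥g h₂⊥g = ⊥₁-add h₁⊥g (⊥₁-resp (λ j → -1*x≈-x _) (⊥₁-scale (- 1#) h₂⊥g))

    ⊥₁-expansion : ∀ {h : I → Carrier} → h ⊥₁ g →
      ∀ m k j → g m k * h j ≈ h k * g m j - h m * g k j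
    ⊥₁-expansion {h} h⊥g m k j = x∙y⁻¹≈ε⇒x≈y _ _ (begin
      g m k * h j - (h k * g m j - h m * g k j)
        ≈⟨ +-congˡ (⁻¹-anti-homo‿- _ _) ⟩
      g m k * h j + (h m * g k j - h k * g m j)
        ≈⟨ +-congˡ (+-comm _ _) ⟩
      g m k * h j + (- (h k * g m j) + h m * g k j)
        ≈⟨ +-assoc _ _ _ ⟨
      (g m k * h j - h k * g m j) + h m * g k j
        ≈⟨ +-cong (+-congˡ (-‿cong (*-comm _ _))) (*-comm _ _) ⟩
      orthogonalityForm g h m k j
        ≈⟨ h⊥g m k j ⟩
      0# ∎)

module _ {c ℓ : Level} (K : Field c ℓ) where
  open Field K
  open Rows commutativeRing
  open SetoidReasoning setoid

  ⊥⇔rows-⊥₁ : ∀ {f g : BSeries K} → _⊥_ K f g ⇔ (∀ k → f k ⊥₁ g)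
  ⊥⇔rows-⊥₁ = mk⇔ (λ f⊥g k i j l → f⊥g i j l k) (λ rows⊥g i j l k → rows⊥g k i j l)

  x*y≈z⇒y≈x⁻¹*z : ∀ {x y z} (x≉0 : ¬ (x ≈ 0#)) → x * y ≈ z → y ≈ inv x x≉0 * z
  x*y≈z⇒y≈x⁻¹*z {x} {y} {z} x≉0 xy≈z = begin
    y                    ≈⟨ *-identityˡ y ⟨
    1# * y               ≈⟨ *-congʳ (trans (*-comm _ _) (inverse x x≉0)) ⟨
    (inv x x≉0 * x) * y  ≈⟨ *-assoc _ _ _ ⟩
    inv x x≉0 * (x * y)  ≈⟨ *-congˡ xy≈z ⟩
    inv x x≉0 * z        ∎

  ⊥⇒row-expansion : ∀ {f g : BSeries K} {m k} (gmk≉0 : ¬ (g m k ≈ 0#)) → _⊥_ K f g →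
    ∀ i j → f i j ≈ inv (g m k) gmk≉0 * (f i k * g m j - f i m * g k j)
  ⊥⇒row-expansion {g = g} {m} {k} gmk≉0 f⊥g i j =
    x*y≈z⇒y≈x⁻¹*z gmk≉0 (⊥₁-expansion g (Equivalence.to ⊥⇔rows-⊥₁ f⊥g i) m k j)

  row-combination-⊥ : ∀ {f g : BSeries K} {m k} (gmk≉0 : ¬ (g m k ≈ 0#)) (P Q : LSeries K) →
    _⊥_ K g g → (∀ i j → f i j ≈ inv (g m k) gmk≉0 * (P i * g m j - Q i * g k j)) →
    _⊥_ K f g
  row-combination-⊥ {g = g} {m} {k} gmk≉0 P Q g⊥g f≈ = Equivalence.from ⊥⇔rows-⊥₁ λ i →
    ⊥₁-resp g (λ j → sym (f≈ i j))
      (⊥₁-scale g (inv (g m k) gmk≉0)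
        (⊥₁-sub g (⊥₁-scale g (P i) (rows⊥g m)) (⊥₁-scale g (Q i) (rows⊥g k))))
    where
      rows⊥g : ∀ n → g n ⊥₁ g
      rows⊥g = Equivalence.to ⊥⇔rows-⊥₁ g⊥g

theorem2p2 : ∀ {c ℓ : Level} (K : Field c ℓ) → let open Field K in
    (g f : BSeries K) → NonZeroSeries K g → _⊥_ K g g →
    (_⊥_ K f g ⇔
      (∃₂ λ (m₀ k₀ : ℤ) → Σ (¬ (g m₀ k₀ ≈ 0#)) λ nz →
        ∃₂ λ (P Q : LSeries K) →
          ∀ (i j : ℤ) →
            f i j ≈ inv (g m₀ k₀) nz * (P i * coeffX K g m₀ j - Q i * coeffX K g k₀ j)))
theorem2p2 K g f (m₀ , k₀ , g₀≉0) g⊥g = mk⇔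
  (λ f⊥g → m₀ , k₀ , g₀≉0 , (λ i → f i k₀) , (λ i → f i m₀) , ⊥⇒row-expansion K g₀≉0 f⊥g)
  (λ { (m , k , gmk≉0 , P , Q , f≈) → row-combination-⊥ K gmk≉0 P Q g⊥g f≈ })
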